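{- Let $\Gamma$ be a $4$-regular infinite planar tessellation with non-negative combinatorial curvature. For $i=1,2$ let $\sigma_i$ be a face of degree $k_i\ge 8$, with $\sigma_1\ne\sigma_2$. Then $\partial\sigma_1\cap\partial\sigma_2=\emptyset$.
   Context: A planar tessellation is a locally finite, connected, simple graph embedded in $\mathbb S^2$ or $\mathbb R^2$, with faces the components of the complement, such that: (i) every closed face is a closed disk bounded by finitely many edges; (ii) every edge lies in exactly two different closed faces; (iii) two distinct closed faces intersect in the empty set, a single vertex, or the closure of a single edge; all vertex and face degrees (face degree = number of boundary edges) are at least $3$. Infinite means embedded in $\mathbb R^2$. The combinatorial curvature at a vertex $x$ is $\Phi(x)=1-\frac{|x|}{2}+\sum_{\sigma}\frac{1}{|\sigma|}$, summed over faces whose closure contains $x$; non-negative curvature means $\Phi\ge0$ at every vertex. $4$-regular means all vertices have degree $4$. For a face $\sigma$, $\partial\sigma$ is the set of vertices in the closure of $\sigma$. -}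

module Defs where

open import Data.Nat using (ℕ; zero; suc; _≤_; _<_)
open import Data.Integer using (+_)
open import Data.Rational using (ℚ; 0ℚ; 1ℚ; _+_; _-_) renaming (_≤_ to _≤ℚ_; _/_ to _/ℚ_)
open import Data.List using (List; []; _∷_; _++_; foldr; map)
open import Data.List.Relation.Unary.All using (All)
open import Data.List.Relation.Unary.Any using (Any)
open import Data.List.Relation.Unary.AllPairs using (AllPairs)
open import Data.List.Membership.Propositional using (_∈_; _∉_)
open import Data.Product using (Σ; ∃; ∃-syntax; _×_; _,_)
open import Data.Sum using (_⊎_)
open import Relation.Nullary using (¬_)
open import Relation.Binary.PropositionalEquality using (_≡_; _≢_)
open import Relation.Binary.Construct.Closure.Equivalence using (EqClosure)

iter : {A : Set} → (A → A) → ℕ → A → A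
iter f zero x = x
iter f (suc n) x = f (iter f n x)

Period : {A : Set} → (A → A) → A → ℕ → Set
Period f x k = 1 ≤ k × iter f k x ≡ x × (∀ j → 1 ≤ j → j < k → iter f j x ≢ x)

-- 1/k as a rational (k = 0 never occurs for degrees ≥ 3)
inv : ℕ → ℚ
inv zero = 0ℚ
inv (suc n) = (+ 1) /ℚ (suc n)

sumℚ : List ℚ → ℚ
sumℚ = foldr _+_ 0ℚ

-- Combinatorial maps (encoding of a cellularly embedded graph).
-- Darts = oriented edges.  α reverses a dart, σ rotates a dart around its
-- tail vertex, φ = σ ∘ α walks along the boundary of a face.
-- Vertices = σ-orbits, edges = α-orbits, faces = φ-orbits.

record CombMap : Set₁ where
  field
    Dart  : Set
    α     : Dart → Dart
    σ     : Dart → Dart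
    σ⁻    : Dart → Dart
    α-invol : ∀ d → α (α d) ≡ d
    α-fpf   : ∀ d → α d ≢ d
    σσ⁻   : ∀ d → σ (σ⁻ d) ≡ d
    σ⁻σ   : ∀ d → σ⁻ (σ d) ≡ d

  φ : Dart → Dart
  φ d = σ (α d)

  SameVertex : Dart → Dart → Set
  SameVertex d e = ∃[ n ] iter σ n d ≡ e

  SameFace : Dart → Dart → Set
  SameFace d e = ∃[ n ] iter φ n d ≡ e

  -- vertex (tail of) x lies in the closure of the face of f, i.e. x ∈ ∂σ
  _∈∂_ : Dart → Dart → Set
  x ∈∂ f = ∃[ i ] SameVertex (iter φ i f) x

  data Reach : Dart → Dart → Set where
    here  : ∀ {d} → Reach d d
    stepα : ∀ {d e} → Reach d e → Reach d (α e)
    stepσ : ∀ {d e} → Reach d e → Reach d (σ e)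

  data IsWalk : List Dart → Set where
    nil  : IsWalk []
    one  : ∀ d → IsWalk (d ∷ [])
    cons : ∀ d e w → SameVertex (α d) e → IsWalk (e ∷ w) → IsWalk (d ∷ e ∷ w)

  data IsClosedWalk : List Dart → Set where
    nil  : IsClosedWalk []
    cyc  : ∀ d w e → IsWalk (d ∷ w ++ e ∷ []) → SameVertex (α e) d
           → IsClosedWalk (d ∷ w ++ e ∷ [])

  faceWalk : ℕ → Dart → List Dart
  faceWalk zero f = []
  faceWalk (suc k) f = f ∷ faceWalk k (φ f)

  data Move (fd : Dart → ℕ) : List Dart → List Dart → Set where
    backtrack : ∀ p q d → IsWalk (p ++ q) → IsWalk (p ++ d ∷ α d ∷ q) →
                Move fd (p ++ d ∷ α d ∷ q) (p ++ q)
    face      : ∀ p q f → IsWalk (p ++ q) → IsWalk (p ++ faceWalk (fd f) f ++ q) →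
                Move fd (p ++ faceWalk (fd f) f ++ q) (p ++ q)

record PlanarTessellation : Set₁ where
  field
    M : CombMap
  open CombMap M public
  field
    vdeg : Dart → ℕ
    fdeg : Dart → ℕ
    vdeg-period : ∀ d → Period σ d (vdeg d)     -- local finiteness
    fdeg-period : ∀ d → Period φ d (fdeg d)     -- faces bounded by finitely many edges
    vdeg≥3 : ∀ d → 3 ≤ vdeg d
    fdeg≥3 : ∀ d → 3 ≤ fdeg d
    connected : ∀ d e → Reach d e
    no-loop  : ∀ d → ¬ SameVertex d (α d)
    no-multi : ∀ d e → SameVertex d e → SameVertex (α d) (α e) → d ≡ e
    -- (i) closed faces are closed disks: the boundary is a simple cycle
    face-simple : ∀ f i j → i < j → j < fdeg f →
                  ¬ SameVertex (iter φ i f) (iter φ j f)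
    edge-two-faces : ∀ d → ¬ SameFace d (α d)
    -- (iii) two distinct closed faces meet in ∅, a vertex, or a closed edge
    face-meet : ∀ f g → ¬ SameFace f g → ∀ u v → u ∈∂ f → u ∈∂ g → v ∈∂ f → v ∈∂ g
                → ¬ SameVertex u v →
                (∃[ x ] (SameFace f x × SameFace g (α x) ×
                         ((SameVertex x u × SameVertex (α x) v) ⊎ (SameVertex x v × SameVertex (α x) u))))
                × (∀ w → w ∈∂ f → w ∈∂ g → SameVertex w u ⊎ SameVertex w v)
    -- planarity: the 2-complex obtained by gluing a disk along each face
    -- boundary walk is simply connected (every closed walk is null-homotopic
    -- via backtrack and face-relator moves)
    simply-connected : ∀ w → IsClosedWalk w → EqClosure (Move fdeg) w []


  -- a list fs enumerates (by representative darts) exactly the faces whose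
  -- closure contains the vertex of x, each face once
  FacesAt : Dart → List Dart → Set
  FacesAt x fs = All (λ f → x ∈∂ f) fs × AllPairs (λ f g → ¬ SameFace f g) fs
                 × (∀ f → x ∈∂ f → Any (SameFace f) fs)

  NonNegCurvAt : Dart → Set
  NonNegCurvAt x = ∀ fs → FacesAt x fs →
    0ℚ ≤ℚ ((1ℚ - ((+ vdeg x) /ℚ 2)) + sumℚ (map (λ f → inv (fdeg f)) fs))

NonNegativeCurvature : PlanarTessellation → Set
NonNegativeCurvature T = ∀ x → PlanarTessellation.NonNegCurvAt T x

FourRegular : PlanarTessellation → Set
FourRegular T = ∀ d → PlanarTessellation.vdeg T d ≡ 4

-- infinite (embedded in ℝ²): infinitely many darts, equivalently (by local
-- finiteness) infinitely many vertices
Infinite : PlanarTessellation → Set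
Infinite T = ∀ (l : List (PlanarTessellation.Dart T)) → ∃[ d ] d ∉ l

{-# OPTIONS --safe #-}
-- At a common vertex x of the two faces, the four darts leaving x lie in four distinct faces
-- (a face boundary is a simple cycle, so it passes through x only once), and every face
-- containing x is one of them.  Two of these are the given faces, of degree at least 8, and
-- the other two have degree at least 3, so Φ(x) ≤ 1 - 4/2 + 1/8 + 1/8 + 1/3 + 1/3 = -1/12.
module Submission where

open import Defs
open import Data.Nat using (zero; suc; _+_; _*_; _∸_; _≤_; _<_; _/_; _%_; NonZero; z<s)
open import Data.Nat.DivMod using (m%n<n; m≡m%n+[m/n]*n)
import Data.Nat.Properties as ℕ
open import Data.Nat.Coprimality using (1-coprimeTo)
open import Data.Integer using (+_)
import Data.Integer as ℤ
import Data.Integer.Properties as ℤ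
open import Data.Rational using (ℚ; 0ℚ; 1ℚ; *≤*) renaming (_≤_ to _≤ℚ_; _≤?_ to _≤ℚ?_; _/_ to _/ℚ_; _+_ to _+ℚ_; _-_ to _-ℚ_)
import Data.Rational.Properties as ℚ
open import Data.Product using (∃-syntax; _×_; _,_; proj₂)
open import Data.Empty using (⊥; ⊥-elim)
open import Data.List using (List; []; _∷_; map; applyUpTo; length)
open import Data.List.Properties using (length-applyUpTo)
open import Data.List.Relation.Unary.Any using (Any; here; there)
import Data.List.Relation.Unary.All.Properties as All
import Data.List.Relation.Unary.AllPairs.Properties as AllPairs
import Data.List.Relation.Unary.Any.Properties as Any
open import Data.List.Relation.Binary.Permutation.Propositional using (_↭_; ↭-refl; ↭-prep; ↭-swap; ↭-trans; ↭⇒↭ₛ)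
open import Data.List.Relation.Binary.Permutation.Propositional.Properties using (↭-length; Any-resp-↭)
import Data.List.Relation.Binary.Permutation.Propositional.Properties as Perm
open import Data.List.Relation.Binary.Permutation.Setoid.Properties using (foldr-commMonoid)
open import Algebra.Bundles using (CommutativeMonoid)
open import Relation.Nullary using (¬_)
open import Relation.Nullary.Decidable using (from-no)
open import Relation.Binary.PropositionalEquality
open ≡-Reasoning

module _ {A : Set} (f : A → A) where

  InOrbit : A → A → Set
  InOrbit x y = ∃[ n ] iter f n x ≡ y

  iter-+ : ∀ m n x → iter f (m + n) x ≡ iter f m (iter f n x)
  iter-+ zero    n x = refl
  iter-+ (suc m) n x = cong f (iter-+ m n x)

  iter-*-fixed : ∀ {m x} → iter f m x ≡ x → ∀ q → iter f (q * m) x ≡ x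
  iter-*-fixed         fx zero    = refl
  iter-*-fixed {m} {x} fx (suc q) = begin
    iter f (m + q * m) x        ≡⟨ iter-+ m (q * m) x ⟩
    iter f m (iter f (q * m) x) ≡⟨ cong (iter f m) (iter-*-fixed fx q) ⟩
    iter f m x                  ≡⟨ fx ⟩
    x                           ∎

  iter-% : ∀ {m x} .{{_ : NonZero m}} → iter f m x ≡ x → ∀ n → iter f (n % m) x ≡ iter f n x
  iter-% {m} {x} fx n = begin
    iter f (n % m) x                      ≡⟨ cong (iter f (n % m)) (iter-*-fixed fx (n / m)) ⟨
    iter f (n % m) (iter f (n / m * m) x) ≡⟨ iter-+ (n % m) (n / m * m) x ⟨
    iter f (n % m + n / m * m) x          ≡⟨ cong (λ k → iter f k x) (m≡m%n+[m/n]*n n m) ⟨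
    iter f n x                            ∎

  iter-fixed-InOrbit : ∀ {p x y} → iter f p x ≡ x → InOrbit x y → iter f p y ≡ y
  iter-fixed-InOrbit {p} {x} fx (n , refl) = begin
    iter f p (iter f n x) ≡⟨ iter-+ p n x ⟨
    iter f (p + n) x      ≡⟨ cong (λ k → iter f k x) (ℕ.+-comm p n) ⟩
    iter f (n + p) x      ≡⟨ iter-+ n p x ⟩
    iter f n (iter f p x) ≡⟨ cong (iter f n) fx ⟩
    iter f n x            ∎

  InOrbit-trans : ∀ {x y z} → InOrbit x y → InOrbit y z → InOrbit x z
  InOrbit-trans {x} (m , refl) (n , refl) = n + m , iter-+ n m x

  InOrbit-sym : ∀ {p x y} → Period f x p → InOrbit x y → InOrbit y x
  InOrbit-sym {suc k} {x} (_ , fx , _) (n , refl) = n * k , (begin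
    iter f (n * k) (iter f n x) ≡⟨ iter-+ (n * k) n x ⟨
    iter f (n * k + n) x        ≡⟨ cong (λ j → iter f j x) (ℕ.+-comm (n * k) n) ⟩
    iter f (n + n * k) x        ≡⟨ cong (λ j → iter f j x) (ℕ.*-suc n k) ⟨
    iter f (n * suc k) x        ≡⟨ iter-*-fixed fx n ⟩
    x                           ∎)

  InOrbit-below-period : ∀ {p x y} → Period f x p → InOrbit x y → ∃[ r ] r < p × iter f r x ≡ y
  InOrbit-below-period {suc k} (_ , fx , _) (n , refl) = n % suc k , m%n<n n (suc k) , iter-% fx n

  Period-minimal : ∀ {p m x} → Period f x p → 1 ≤ m → iter f m x ≡ x → p ≤ m
  Period-minimal (_ , _ , minimal) 1≤m fx = ℕ.≮⇒≥ (λ m<p → minimal _ 1≤m m<p fx)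

  Period-InOrbit : ∀ {p q x y} → Period f x p → Period f y q → InOrbit x y → p ≡ q
  Period-InOrbit perˣ perʸ x~y =
    ℕ.≤-antisym (Period-≥ perʸ perˣ (InOrbit-sym perˣ x~y)) (Period-≥ perˣ perʸ x~y)
    where
    Period-≥ : ∀ {p q x y} → Period f x p → Period f y q → InOrbit x y → q ≤ p
    Period-≥ {p} (1≤p , fx , _) perʸ x~y = Period-minimal perʸ 1≤p (iter-fixed-InOrbit {p} fx x~y)

Any-extract : ∀ {A : Set} {P : A → Set} {xs} → Any P xs → ∃[ y ] ∃[ ys ] P y × xs ↭ y ∷ ys
Any-extract (here py) = _ , _ , py , ↭-refl
Any-extract {xs = x ∷ _} (there any) with Any-extract any
... | y , ys , py , xs↭ = y , x ∷ ys , py , ↭-trans (↭-prep x xs↭) (↭-swap x y ↭-refl)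

sumℚ-↭ : ∀ {qs rs} → qs ↭ rs → sumℚ qs ≡ sumℚ rs
sumℚ-↭ p = foldr-commMonoid ℚ+.setoid ℚ+.isCommutativeMonoid (↭⇒↭ₛ p)
  where module ℚ+ = CommutativeMonoid ℚ.+-0-commutativeMonoid

inv-antitone : ∀ {m n} → 1 ≤ m → m ≤ n → inv n ≤ℚ inv m
inv-antitone {suc m} {suc n} _ m≤n
  rewrite ℚ.normalize-coprime {1} {n} (1-coprimeTo (suc n))
        | ℚ.normalize-coprime {1} {m} (1-coprimeTo (suc m))
  = *≤* (subst₂ ℤ._≤_ (sym (ℤ.*-identityˡ (+ suc m))) (sym (ℤ.*-identityˡ (+ suc n))) (ℤ.+≤+ m≤n))

curvature-4-two-large-faces : ∀ {a b c d} → a ≤ℚ inv 8 → b ≤ℚ inv 8 → c ≤ℚ inv 3 → d ≤ℚ inv 3 →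
  ¬ 0ℚ ≤ℚ (1ℚ -ℚ (+ 4) /ℚ 2) +ℚ sumℚ (a ∷ b ∷ c ∷ d ∷ [])
curvature-4-two-large-faces {a} {b} {c} {d} a≤ b≤ c≤ d≤ 0≤Φ =
  from-no (0ℚ ≤ℚ? Φ-bound) (ℚ.≤-trans 0≤Φ (ℚ.+-monoʳ-≤ (1ℚ -ℚ (+ 4) /ℚ 2) sum≤))
  where
  Φ-bound : ℚ
  Φ-bound = (1ℚ -ℚ (+ 4) /ℚ 2) +ℚ sumℚ (inv 8 ∷ inv 8 ∷ inv 3 ∷ inv 3 ∷ [])
  sum≤ : sumℚ (a ∷ b ∷ c ∷ d ∷ []) ≤ℚ sumℚ (inv 8 ∷ inv 8 ∷ inv 3 ∷ inv 3 ∷ [])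
  sum≤ = ℚ.+-mono-≤ a≤ (ℚ.+-mono-≤ b≤ (ℚ.+-mono-≤ c≤ (ℚ.+-mono-≤ d≤ (ℚ.≤-refl {0ℚ}))))

module Tessellation (T : PlanarTessellation) where
  open PlanarTessellation T

  SameFace-sym : ∀ {d e} → SameFace d e → SameFace e d
  SameFace-sym = InOrbit-sym φ (fdeg-period _)

  SameFace-trans : ∀ {d e g} → SameFace d e → SameFace e g → SameFace d g
  SameFace-trans = InOrbit-trans φ

  SameVertex-sym : ∀ {d e} → SameVertex d e → SameVertex e d
  SameVertex-sym = InOrbit-sym σ (vdeg-period _)

  fdeg-SameFace : ∀ {d e} → SameFace d e → fdeg d ≡ fdeg e
  fdeg-SameFace = Period-InOrbit φ (fdeg-period _) (fdeg-period _)

  vdeg-SameVertex : ∀ {d e} → SameVertex d e → vdeg d ≡ vdeg e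
  vdeg-SameVertex = Period-InOrbit σ (vdeg-period _) (vdeg-period _)

  rotation-changes-face : ∀ {e j} → 1 ≤ j → j < vdeg e → ¬ SameFace e (iter σ j e)
  rotation-changes-face {e} {j} 1≤j j<vdeg e~σʲe with InOrbit-below-period φ (fdeg-period e) e~σʲe
  ... | zero  , _       , e≡σʲe   = proj₂ (proj₂ (vdeg-period e)) j 1≤j j<vdeg (sym e≡σʲe)
  ... | suc r , r<fdeg , φʳe≡σʲe = face-simple e 0 (suc r) z<s r<fdeg (j , sym φʳe≡σʲe)

  corners : Dart → List Dart
  corners x = applyUpTo (λ r → iter σ r x) (vdeg x)

  corner-∈∂ : ∀ {x} r → x ∈∂ iter σ r x
  corner-∈∂ r = 0 , SameVertex-sym (r , refl)

  corners-in-distinct-faces : ∀ {x i j} → i < j → j < vdeg x → ¬ SameFace (iter σ i x) (iter σ j x)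
  corners-in-distinct-faces {x} {i} {j} i<j j<vdeg =
    subst (λ y → ¬ SameFace (iter σ i x) y) σʲ⁻ⁱσⁱx≡σʲx
      (rotation-changes-face (ℕ.m<n⇒0<n∸m i<j) j∸i<vdeg)
    where
    σʲ⁻ⁱσⁱx≡σʲx : iter σ (j ∸ i) (iter σ i x) ≡ iter σ j x
    σʲ⁻ⁱσⁱx≡σʲx =
      trans (sym (iter-+ σ (j ∸ i) i x)) (cong (λ k → iter σ k x) (ℕ.m∸n+n≡m (ℕ.<⇒≤ i<j)))
    j∸i<vdeg : j ∸ i < vdeg (iter σ i x)
    j∸i<vdeg = subst (j ∸ i <_) (vdeg-SameVertex (i , refl)) (ℕ.≤-<-trans (ℕ.m∸n≤m j i) j<vdeg)

  face-at-corner : ∀ {x f} → x ∈∂ f → ∃[ r ] r < vdeg x × SameFace f (iter σ r x)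
  face-at-corner {x} (i , φⁱf~x) with InOrbit-below-period σ (vdeg-period x) (SameVertex-sym φⁱf~x)
  ... | r , r<vdeg , σʳx≡φⁱf = r , r<vdeg , i , sym σʳx≡φⁱf

  corners-enumerate-faces : ∀ x → FacesAt x (corners x)
  corners-enumerate-faces x =
      All.applyUpTo⁺₁ _ (vdeg x) (λ {r} _ → corner-∈∂ r)
    , AllPairs.applyUpTo⁺₁ _ (vdeg x) corners-in-distinct-faces
    , λ f x∈f → let r , r<vdeg , f~σʳx = face-at-corner x∈f in Any.applyUpTo⁺ _ f~σʳx r<vdeg

  two-faces-first : ∀ {x fs f₁ f₂} → FacesAt x fs → x ∈∂ f₁ → x ∈∂ f₂ → ¬ SameFace f₁ f₂ →
    ∃[ g₁ ] ∃[ g₂ ] ∃[ rest ] SameFace f₁ g₁ × SameFace f₂ g₂ × fs ↭ g₁ ∷ g₂ ∷ rest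
  two-faces-first (_ , _ , complete) x∈f₁ x∈f₂ f₁≁f₂ with Any-extract (complete _ x∈f₁)
  ... | g₁ , rest₁ , f₁~g₁ , fs↭ with Any-resp-↭ fs↭ (complete _ x∈f₂)
  ...   | here f₂~g₁ = ⊥-elim (f₁≁f₂ (SameFace-trans f₁~g₁ (SameFace-sym f₂~g₁)))
  ...   | there f₂∈rest₁ with Any-extract f₂∈rest₁
  ...     | g₂ , rest , f₂~g₂ , rest₁↭ = g₁ , g₂ , rest , f₁~g₁ , f₂~g₂ , ↭-trans fs↭ (↭-prep g₁ rest₁↭)

  two-large-faces⇒negative-curvature : ∀ {x f₁ f₂} → vdeg x ≡ 4 → x ∈∂ f₁ → x ∈∂ f₂ → ¬ SameFace f₁ f₂ →
    8 ≤ fdeg f₁ → 8 ≤ fdeg f₂ → ¬ NonNegCurvAt x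
  two-large-faces⇒negative-curvature {x} vdeg≡4 x∈f₁ x∈f₂ f₁≁f₂ 8≤f₁ 8≤f₂ nonneg
    with two-faces-first (corners-enumerate-faces x) x∈f₁ x∈f₂ f₁≁f₂
  ... | g₁ , g₂ , others , f₁~g₁ , f₂~g₂ , corners↭ =
    four-faces others (trans (sym (↭-length corners↭)) (trans (length-applyUpTo _ (vdeg x)) vdeg≡4))
      corners↭
    where
    term : Dart → ℚ
    term f = inv (fdeg f)

    large-term : ∀ {f g} → SameFace f g → 8 ≤ fdeg f → term g ≤ℚ inv 8
    large-term f~g 8≤f = inv-antitone z<s (subst (8 ≤_) (fdeg-SameFace f~g) 8≤f)

    four-faces : ∀ others → 2 + length others ≡ 4 → corners x ↭ g₁ ∷ g₂ ∷ others → ⊥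
    four-faces (h₁ ∷ h₂ ∷ []) refl corners↭ =
      curvature-4-two-large-faces (large-term f₁~g₁ 8≤f₁) (large-term f₂~g₂ 8≤f₂)
        (inv-antitone z<s (fdeg≥3 h₁)) (inv-antitone z<s (fdeg≥3 h₂))
        (subst (0ℚ ≤ℚ_) Φ-rearranged (nonneg (corners x) (corners-enumerate-faces x)))
      where
      Φ-rearranged : (1ℚ -ℚ (+ vdeg x) /ℚ 2) +ℚ sumℚ (map term (corners x))
                   ≡ (1ℚ -ℚ (+ 4) /ℚ 2) +ℚ sumℚ (map term (g₁ ∷ g₂ ∷ h₁ ∷ h₂ ∷ []))
      Φ-rearranged = cong₂ (λ n s → (1ℚ -ℚ (+ n) /ℚ 2) +ℚ s) vdeg≡4 (sumℚ-↭ (Perm.map⁺ term corners↭))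

proposition4p3 : (T : PlanarTessellation) → Infinite T → FourRegular T → NonNegativeCurvature T →
    (f₁ f₂ : PlanarTessellation.Dart T) →
    8 ≤ PlanarTessellation.fdeg T f₁ → 8 ≤ PlanarTessellation.fdeg T f₂ →
    ¬ PlanarTessellation.SameFace T f₁ f₂ →
    ¬ (∃[ x ] (PlanarTessellation._∈∂_ T x f₁ × PlanarTessellation._∈∂_ T x f₂))
proposition4p3 T _ four-regular nonneg f₁ f₂ 8≤f₁ 8≤f₂ f₁≁f₂ (x , x∈f₁ , x∈f₂) =
  two-large-faces⇒negative-curvature (four-regular x) x∈f₁ x∈f₂ f₁≁f₂ 8≤f₁ 8≤f₂ (nonneg x)
  where open Tessellation T
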